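{- Let $M$ be an elementary split matroid of rank $n$. Then every point of $M$ of degree at most two is $2$-simple.
   Context: Elementary split matroid: for subsets $H_1,\ldots,H_q$ of the ground set $[d]$ and positive integers $r_i$ with $|H_i\cap H_j|\leq r_i+r_j-n$ ($i\neq j$), $|[d]\setminus H_i|\geq n-r_i$, $r_i\leq n-1$, $|H_i|\geq r_i+1$, the rank-$n$ matroid with independent sets $\{X:|X|\leq n,\ |X\cap H_i|\leq r_i\ \forall i\}$. Subspaces: circuits of size at most $n$ grouped by $C_1\sim C_2\iff\mathrm{cl}(C_1)=\mathrm{cl}(C_2)$; each class $l$ is a subspace, identified with the set of points lying in some circuit of the class. For a point $p$, $\mathcal{L}_p$ is the set of subspaces containing $p$ and $\deg(p)=|\mathcal{L}_p|$. A point $p$ is $2$-simple if either $|\mathcal{L}_p|\leq 1$, or $\mathcal{L}_p=\{l_1,l_2\}$ with $\mathrm{rank}(l_1\cup l_2)=n$. -}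

module Defs where

open import Data.Nat using (ℕ; suc; _+_; _≤_)
open import Data.Fin using (Fin)
open import Data.Fin.Subset using (Subset; _∈_; _⊂_; _∩_; ∁; ∣_∣)
open import Data.Product using (Σ; _×_)
open import Data.Sum using (_⊎_)
open import Relation.Nullary using (¬_)
open import Relation.Binary.PropositionalEquality using (_≡_; _≢_)

-- Elementary split matroid of rank n on ground set [d] = Fin d,
-- given by hyperplane-like sets H₁..H_q with ranks r₁..r_q.
record ElementarySplit (n d : ℕ) : Set where
  field
    q    : ℕ
    H    : Fin q → Subset d
    r    : Fin q → ℕ
    r-pos    : ∀ i → 1 ≤ r i
    -- |H_i ∩ H_j| ≤ r_i + r_j - n   (integer subtraction, written additively)
    inter    : ∀ i j → i ≢ j → ∣ H i ∩ H j ∣ + n ≤ r i + r j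
    compl    : ∀ i → n ≤ ∣ ∁ (H i) ∣ + r i
    r-small  : ∀ i → suc (r i) ≤ n
    H-large  : ∀ i → suc (r i) ≤ ∣ H i ∣
    -- the matroid has rank n (needed when q = 0)
    n≤d      : n ≤ d

module _ {n d : ℕ} (M : ElementarySplit n d) where
  open ElementarySplit M

  Indep : Subset d → Set
  Indep X = ∣ X ∣ ≤ n × (∀ i → ∣ X ∩ H i ∣ ≤ r i)

  Circuit : Subset d → Set
  Circuit C = ¬ Indep C × (∀ Y → Y ⊂ C → Indep Y)

  HasRank : (Fin d → Set) → ℕ → Set
  HasRank S k =
    Σ (Subset d) (λ I → (∀ {x} → x ∈ I → S x) × Indep I × ∣ I ∣ ≡ k)
    × (∀ J → (∀ {x} → x ∈ J → S x) → Indep J → ∣ J ∣ ≤ k)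

  Cl : Subset d → Fin d → Set
  Cl C x = Σ ℕ (λ k → HasRank (λ y → y ∈ C) k × HasRank (λ y → y ∈ C ⊎ y ≡ x) k)

  SmallCircuit : Subset d → Set
  SmallCircuit C = Circuit C × ∣ C ∣ ≤ n

  _∼_ : Subset d → Subset d → Set
  C₁ ∼ C₂ = ∀ x → (Cl C₁ x → Cl C₂ x) × (Cl C₂ x → Cl C₁ x)

  -- the subspace (class) of the circuit C, as the set of points lying in
  -- some small circuit of the class
  Pts : Subset d → Fin d → Set
  Pts C x = Σ (Subset d) (λ C' → SmallCircuit C' × C' ∼ C × x ∈ C')

  -- the class of C is a subspace belonging to 𝓛_p
  InL : Fin d → Subset d → Set
  InL p C = SmallCircuit C × Pts C p

  -- deg(p) = |𝓛_p| ≤ 2 : among any three subspaces through p two coincide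
  DegAtMost2 : Fin d → Set
  DegAtMost2 p = ∀ C₁ C₂ C₃ → InL p C₁ → InL p C₂ → InL p C₃ →
                 C₁ ∼ C₂ ⊎ (C₁ ∼ C₃ ⊎ C₂ ∼ C₃)

  -- p is 2-simple: |𝓛_p| ≤ 1, or 𝓛_p = {l₁, l₂} with rank(l₁ ∪ l₂) = n
  TwoSimple : Fin d → Set
  TwoSimple p =
    (∀ C₁ C₂ → InL p C₁ → InL p C₂ → C₁ ∼ C₂)
    ⊎ Σ (Subset d) (λ C₁ → Σ (Subset d) (λ C₂ →
        InL p C₁ × InL p C₂ × ¬ (C₁ ∼ C₂)
        × (∀ C → InL p C → C ∼ C₁ ⊎ C ∼ C₂)
        × HasRank (λ x → Pts C₁ x ⊎ Pts C₂ x) n))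

-- A circuit C of size at most n lies inside some H_i with |C| > r_i, and then
-- cl(C) = H_i: any r_i points of C are a basis of C, and a point off H_i would
-- extend them to an independent set. So the subspaces through p are exactly the
-- sets H_i containing p. If p lies on at most one H_i, there is at most one
-- subspace through p. If p lies on H_i and H_j with i ≠ j, these subspaces are
-- distinct, degree at most two says there are no others, and r_i points of H_i
-- together with n − r_i points of H_j ∖ H_i are independent, so rank(H_i ∪ H_j) = n.
module Submission where

open import Defs
open import Data.Nat using (ℕ; zero; suc; _+_; _∸_; _≤_; _≰_; _<_; z≤n; s≤s; _≤?_)
open import Data.Nat.Properties hiding (_≟_)
open import Data.Fin using (Fin; _≟_)
open import Data.Fin.Subset
open import Data.Fin.Subset.Properties
open import Data.Fin.Properties using (any?; ¬∀⟶∃¬)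
open import Data.Vec using (_∷_; []; here; there)
open import Data.Product using (_×_; _,_; proj₁; proj₂; ∃; ∃₂)
open import Data.Sum using (_⊎_; inj₁; inj₂)
open import Function.Base using (_∘_)
open import Function.Bundles using (_⇔_; mk⇔; Equivalence)
open import Relation.Nullary using (¬_; yes; no; contradiction)
open import Relation.Nullary.Decidable using (_×-dec_; ¬?; decidable-stable)
open import Relation.Binary.PropositionalEquality

∣p∣≡∣p∩q∣+∣p∩∁q∣ : ∀ {m} (p q : Subset m) → ∣ p ∣ ≡ ∣ p ∩ q ∣ + ∣ p ∩ ∁ q ∣
∣p∣≡∣p∩q∣+∣p∩∁q∣ []            []            = refl
∣p∣≡∣p∩q∣+∣p∩∁q∣ (outside ∷ p) (_       ∷ q) = ∣p∣≡∣p∩q∣+∣p∩∁q∣ p q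
∣p∣≡∣p∩q∣+∣p∩∁q∣ (inside  ∷ p) (inside  ∷ q) = cong suc (∣p∣≡∣p∩q∣+∣p∩∁q∣ p q)
∣p∣≡∣p∩q∣+∣p∩∁q∣ (inside  ∷ p) (outside ∷ q) =
  trans (cong suc (∣p∣≡∣p∩q∣+∣p∩∁q∣ p q)) (sym (+-suc _ _))

∣p∪q∣≤∣p∣+∣q∣ : ∀ {m} (p q : Subset m) → ∣ p ∪ q ∣ ≤ ∣ p ∣ + ∣ q ∣
∣p∪q∣≤∣p∣+∣q∣ []            []            = z≤n
∣p∪q∣≤∣p∣+∣q∣ (outside ∷ p) (outside ∷ q) = ∣p∪q∣≤∣p∣+∣q∣ p q
∣p∪q∣≤∣p∣+∣q∣ (outside ∷ p) (inside  ∷ q) =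
  ≤-trans (s≤s (∣p∪q∣≤∣p∣+∣q∣ p q)) (≤-reflexive (sym (+-suc ∣ p ∣ ∣ q ∣)))
∣p∪q∣≤∣p∣+∣q∣ (inside  ∷ p) (b       ∷ q) =
  s≤s (≤-trans (∣p∪q∣≤∣p∣+∣q∣ p q) (+-monoʳ-≤ ∣ p ∣ (∣p∣≤∣x∷p∣ b q)))

∣p∪q∣≡∣p∣+∣q∣ : ∀ {m} (p q : Subset m) → q ⊆ ∁ p → ∣ p ∪ q ∣ ≡ ∣ p ∣ + ∣ q ∣
∣p∪q∣≡∣p∣+∣q∣ []            []            _    = refl
∣p∪q∣≡∣p∣+∣q∣ (outside ∷ p) (outside ∷ q) q⊆∁p = ∣p∪q∣≡∣p∣+∣q∣ p q (drop-∷-⊆ q⊆∁p)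
∣p∪q∣≡∣p∣+∣q∣ (outside ∷ p) (inside  ∷ q) q⊆∁p =
  trans (cong suc (∣p∪q∣≡∣p∣+∣q∣ p q (drop-∷-⊆ q⊆∁p))) (sym (+-suc ∣ p ∣ ∣ q ∣))
∣p∪q∣≡∣p∣+∣q∣ (inside  ∷ p) (outside ∷ q) q⊆∁p = cong suc (∣p∪q∣≡∣p∣+∣q∣ p q (drop-∷-⊆ q⊆∁p))
∣p∪q∣≡∣p∣+∣q∣ (inside  ∷ p) (inside  ∷ q) q⊆∁p with q⊆∁p here
... | ()

∣[p∪q]∩s∣≤∣p∩s∣+∣q∩s∣ : ∀ {m} (p q s : Subset m) → ∣ (p ∪ q) ∩ s ∣ ≤ ∣ p ∩ s ∣ + ∣ q ∩ s ∣
∣[p∪q]∩s∣≤∣p∩s∣+∣q∩s∣ p q s rewrite ∩-distribʳ-∪ s p q = ∣p∪q∣≤∣p∣+∣q∣ (p ∩ s) (q ∩ s)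

p⊆q⇒∣p∩s∣≤∣q∩s∣ : ∀ {m} {p q s : Subset m} → p ⊆ q → ∣ p ∩ s ∣ ≤ ∣ q ∩ s ∣
p⊆q⇒∣p∩s∣≤∣q∩s∣ {p = p} {s = s} p⊆q =
  p⊆q⇒∣p∣≤∣q∣ λ y∈ → x∈p∩q⁺ (p⊆q (proj₁ (x∈p∩q⁻ p s y∈)) , proj₂ (x∈p∩q⁻ p s y∈))

p⊆q⇒∣p∣≤∣p∩q∣ : ∀ {m} {p q : Subset m} → p ⊆ q → ∣ p ∣ ≤ ∣ p ∩ q ∣
p⊆q⇒∣p∣≤∣p∩q∣ p⊆q = p⊆q⇒∣p∣≤∣q∣ λ y∈ → x∈p∩q⁺ (y∈ , p⊆q y∈)

Empty⇒∣p∣≡0 : ∀ {m} {p : Subset m} → Empty p → ∣ p ∣ ≡ 0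
Empty⇒∣p∣≡0 {m} e = trans (cong ∣_∣ (Empty-unique e)) (∣⊥∣≡0 m)

p⊆∁q⇒∣p∩q∣≡0 : ∀ {m} (p q : Subset m) → p ⊆ ∁ q → ∣ p ∩ q ∣ ≡ 0
p⊆∁q⇒∣p∩q∣≡0 p q p⊆∁q = Empty⇒∣p∣≡0 λ (y , y∈) →
  x∈∁p⇒x∉p (p⊆∁q (proj₁ (x∈p∩q⁻ p q y∈))) (proj₂ (x∈p∩q⁻ p q y∈))

0<∣p∣⇒Nonempty : ∀ {m} (p : Subset m) → 0 < ∣ p ∣ → Nonempty p
0<∣p∣⇒Nonempty p 0<∣p∣ with nonempty? p
... | yes ne = ne
... | no  e  = contradiction (Empty⇒∣p∣≡0 e) (>⇒≢ 0<∣p∣)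

∣p∩q∣<∣p∣⇒∃∈p∉q : ∀ {m} (p q : Subset m) → ∣ p ∩ q ∣ < ∣ p ∣ → ∃ λ y → y ∈ p × y ∉ q
∣p∩q∣<∣p∣⇒∃∈p∉q p q lt =
  let y , y∈ = 0<∣p∣⇒Nonempty (p ∩ ∁ q) 0<∣p∖q∣
      y∈p , y∈∁q = x∈p∩q⁻ p (∁ q) y∈
  in  y , y∈p , x∈∁p⇒x∉p y∈∁q
  where
  0<∣p∖q∣ : 0 < ∣ p ∩ ∁ q ∣
  0<∣p∖q∣ = +-cancelˡ-≤ ∣ p ∩ q ∣ 1 _
    (subst₂ _≤_ (sym (+-comm ∣ p ∩ q ∣ 1)) (∣p∣≡∣p∩q∣+∣p∩∁q∣ p q) lt)

∃⊆-of-size : ∀ {m} (p : Subset m) k → k ≤ ∣ p ∣ → ∃ λ s → s ⊆ p × ∣ s ∣ ≡ k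
∃⊆-of-size []            zero    _       = [] , (λ y∈ → y∈) , refl
∃⊆-of-size (outside ∷ p) k       k≤      with ∃⊆-of-size p k k≤
... | s , s⊆p , ∣s∣≡k = outside ∷ s , out⊆ s⊆p , ∣s∣≡k
∃⊆-of-size (inside  ∷ p) zero    _       with ∃⊆-of-size p zero z≤n
... | s , s⊆p , ∣s∣≡k = outside ∷ s , out⊆ s⊆p , ∣s∣≡k
∃⊆-of-size (inside  ∷ p) (suc k) (s≤s k≤) with ∃⊆-of-size p k k≤
... | s , s⊆p , ∣s∣≡k = inside ∷ s , in⊆in s⊆p , cong suc ∣s∣≡k

∃⊆∋-of-size : ∀ {m} (p : Subset m) {x} → x ∈ p → ∀ k → k < ∣ p ∣ →
  ∃ λ s → s ⊆ p × x ∈ s × ∣ s ∣ ≡ suc k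
∃⊆∋-of-size (inside ∷ p) here k (s≤s k≤) with ∃⊆-of-size p k k≤
... | s , s⊆p , ∣s∣≡k = inside ∷ s , in⊆in s⊆p , here , cong suc ∣s∣≡k
∃⊆∋-of-size (outside ∷ p) (there x∈p) k k< with ∃⊆∋-of-size p x∈p k k<
... | s , s⊆p , x∈s , ∣s∣≡1+k = outside ∷ s , out⊆ s⊆p , there x∈s , ∣s∣≡1+k
∃⊆∋-of-size (inside ∷ p) (there x∈p) zero _
  with ∃⊆∋-of-size p x∈p zero (≤-trans (s≤s z≤n) (x∈p⇒∣p-x∣<∣p∣ x∈p))
... | s , s⊆p , x∈s , ∣s∣≡1 = outside ∷ s , out⊆ s⊆p , there x∈s , ∣s∣≡1
∃⊆∋-of-size (inside ∷ p) (there x∈p) (suc k) (s≤s k<) with ∃⊆∋-of-size p x∈p k k<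
... | s , s⊆p , x∈s , ∣s∣≡1+k = inside ∷ s , in⊆in s⊆p , there x∈s , cong suc ∣s∣≡1+k

module _ {n d : ℕ} (M : ElementarySplit n d) where
  open ElementarySplit M

  private
    variable
      i j l : Fin q
      A B C C′ : Subset d
      S : Fin d → Set
      k k′ : ℕ

  Overfull : Fin q → Subset d → Set
  Overfull i C = C ⊆ H i × r i < ∣ C ∣

  rᵢ≤n : ∀ i → r i ≤ n
  rᵢ≤n i = <⇒≤ (r-small i)

  ∣Hᵢ∩Hₗ∣+[n∸rᵢ]≤rₗ : i ≢ l → ∣ H i ∩ H l ∣ + (n ∸ r i) ≤ r l
  ∣Hᵢ∩Hₗ∣+[n∸rᵢ]≤rₗ {i} {l} i≢l = +-cancelʳ-≤ (r i) _ (r l) (begin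
    ∣ H i ∩ H l ∣ + (n ∸ r i) + r i  ≡⟨ +-assoc ∣ H i ∩ H l ∣ (n ∸ r i) (r i) ⟩
    ∣ H i ∩ H l ∣ + (n ∸ r i + r i)  ≡⟨ cong (∣ H i ∩ H l ∣ +_) (m∸n+n≡m (rᵢ≤n i)) ⟩
    ∣ H i ∩ H l ∣ + n                ≤⟨ inter i l i≢l ⟩
    r i + r l                        ≡⟨ +-comm (r i) (r l) ⟩
    r l + r i                        ∎)
    where open ≤-Reasoning

  n∸rᵢ≤∣Hⱼ∖Hᵢ∣ : j ≢ i → n ∸ r i ≤ ∣ H j ∩ ∁ (H i) ∣
  n∸rᵢ≤∣Hⱼ∖Hᵢ∣ {j} {i} j≢i =
    ≤-trans (∸-monoˡ-≤ (r i) n≤) (≤-reflexive (m+n∸n≡m ∣ H j ∩ ∁ (H i) ∣ (r i)))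
    where
    open ≤-Reasoning
    n≤ : n ≤ ∣ H j ∩ ∁ (H i) ∣ + r i
    n≤ = +-cancelˡ-≤ ∣ H j ∩ H i ∣ n _ (begin
      ∣ H j ∩ H i ∣ + n                             ≤⟨ inter j i j≢i ⟩
      r j + r i                                     ≤⟨ +-monoˡ-≤ (r i) (<⇒≤ (H-large j)) ⟩
      ∣ H j ∣ + r i                                 ≡⟨ cong (_+ r i) (∣p∣≡∣p∩q∣+∣p∩∁q∣ (H j) (H i)) ⟩
      ∣ H j ∩ H i ∣ + ∣ H j ∩ ∁ (H i) ∣ + r i       ≡⟨ +-assoc ∣ H j ∩ H i ∣ _ (r i) ⟩
      ∣ H j ∩ H i ∣ + (∣ H j ∩ ∁ (H i) ∣ + r i)     ∎)

  -- Every other H_l meets A in at most |H_i ∩ H_l| ≤ r_i + r_l − n points,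
  -- which leaves room for all of B.
  ∪-indep : ∀ i → A ⊆ H i → ∣ A ∣ ≤ r i → B ⊆ ∁ (H i) → ∣ B ∣ ≤ n ∸ r i →
            Indep M (A ∪ B)
  ∪-indep {A} {B} i A⊆Hᵢ ∣A∣≤rᵢ B⊆∁Hᵢ ∣B∣≤n∸rᵢ = size , meets
    where
    open ≤-Reasoning
    size : ∣ A ∪ B ∣ ≤ n
    size = begin
      ∣ A ∪ B ∣        ≤⟨ ∣p∪q∣≤∣p∣+∣q∣ A B ⟩
      ∣ A ∣ + ∣ B ∣    ≤⟨ +-mono-≤ ∣A∣≤rᵢ ∣B∣≤n∸rᵢ ⟩
      r i + (n ∸ r i)  ≡⟨ m+[n∸m]≡n (rᵢ≤n i) ⟩
      n                ∎
    meets : ∀ l → ∣ (A ∪ B) ∩ H l ∣ ≤ r l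
    meets l with l ≟ i
    ... | yes refl = begin
      ∣ (A ∪ B) ∩ H i ∣          ≤⟨ ∣[p∪q]∩s∣≤∣p∩s∣+∣q∩s∣ A B (H i) ⟩
      ∣ A ∩ H i ∣ + ∣ B ∩ H i ∣  ≡⟨ cong (∣ A ∩ H i ∣ +_) (p⊆∁q⇒∣p∩q∣≡0 B (H i) B⊆∁Hᵢ) ⟩
      ∣ A ∩ H i ∣ + 0            ≡⟨ +-identityʳ ∣ A ∩ H i ∣ ⟩
      ∣ A ∩ H i ∣                ≤⟨ ∣p∩q∣≤∣p∣ A (H i) ⟩
      ∣ A ∣                      ≤⟨ ∣A∣≤rᵢ ⟩
      r i                        ∎
    ... | no l≢i = begin
      ∣ (A ∪ B) ∩ H l ∣          ≤⟨ ∣[p∪q]∩s∣≤∣p∩s∣+∣q∩s∣ A B (H l) ⟩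
      ∣ A ∩ H l ∣ + ∣ B ∩ H l ∣  ≤⟨ +-mono-≤ (p⊆q⇒∣p∩s∣≤∣q∩s∣ A⊆Hᵢ)
                                            (≤-trans (∣p∩q∣≤∣p∣ B (H l)) ∣B∣≤n∸rᵢ) ⟩
      ∣ H i ∩ H l ∣ + (n ∸ r i)  ≤⟨ ∣Hᵢ∩Hₗ∣+[n∸rᵢ]≤rₗ (λ i≡l → l≢i (sym i≡l)) ⟩
      r l                        ∎

  ⊆Hᵢ-indep : ∀ i → A ⊆ H i → ∣ A ∣ ≤ r i → Indep M A
  ⊆Hᵢ-indep {A} i A⊆Hᵢ ∣A∣≤rᵢ =
    subst (Indep M) (∪-identityʳ A)
      (∪-indep i A⊆Hᵢ ∣A∣≤rᵢ ⊥⊆ (subst (_≤ n ∸ r i) (sym (∣⊥∣≡0 d)) z≤n))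

  indep-⊆Hᵢ⇒∣A∣≤rᵢ : Indep M A → A ⊆ H i → ∣ A ∣ ≤ r i
  indep-⊆Hᵢ⇒∣A∣≤rᵢ {i = i} (_ , meets) A⊆Hᵢ = ≤-trans (p⊆q⇒∣p∣≤∣p∩q∣ A⊆Hᵢ) (meets i)

  HasRank-unique : HasRank M S k → HasRank M S k′ → k ≡ k′
  HasRank-unique ((I , I⊆S , I-indep , ∣I∣≡k) , ≤k) ((I′ , I′⊆S , I′-indep , ∣I′∣≡k′) , ≤k′) =
    ≤-antisym (subst (_≤ _) ∣I∣≡k (≤k′ I I⊆S I-indep))
              (subst (_≤ _) ∣I′∣≡k′ (≤k I′ I′⊆S I′-indep))

  HasRank-rᵢ : ∀ i → (∀ {x} → S x → x ∈ H i) →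
               (∀ {x} → x ∈ A → S x) → ∣ A ∣ ≡ r i → HasRank M S (r i)
  HasRank-rᵢ i S⊆Hᵢ A⊆S ∣A∣≡rᵢ =
    (_ , A⊆S , ⊆Hᵢ-indep i (S⊆Hᵢ ∘ A⊆S) (≤-reflexive ∣A∣≡rᵢ) , ∣A∣≡rᵢ) ,
    λ J J⊆S J-indep → indep-⊆Hᵢ⇒∣A∣≤rᵢ J-indep (S⊆Hᵢ ∘ J⊆S)

  HasRank-n : (∀ {x} → x ∈ A → S x) → Indep M A → ∣ A ∣ ≡ n → HasRank M S n
  HasRank-n A⊆S A-indep ∣A∣≡n = (_ , A⊆S , A-indep , ∣A∣≡n) , λ _ _ J-indep → proj₁ J-indep

  -- A dependent set of size ≤ n overfills some H_i, and a circuit must then lie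
  -- inside that H_i, since its trace on H_i is already dependent.
  smallCircuit⇒Overfull : SmallCircuit M C → ∃ λ i → Overfull i C
  smallCircuit⇒Overfull {C} ((dependent , minimal) , ∣C∣≤n)
    with ¬∀⟶∃¬ q _ (λ i → ∣ C ∩ H i ∣ ≤? r i) (λ meets → dependent (∣C∣≤n , meets))
  ... | i , ∣C∩Hᵢ∣≰rᵢ = i , C⊆Hᵢ , ≤-trans rᵢ<∣C∩Hᵢ∣ (∣p∩q∣≤∣p∣ C (H i))
    where
    rᵢ<∣C∩Hᵢ∣ : r i < ∣ C ∩ H i ∣
    rᵢ<∣C∩Hᵢ∣ = ≰⇒> ∣C∩Hᵢ∣≰rᵢ
    C⊆Hᵢ : C ⊆ H i
    C⊆Hᵢ {x} x∈C with x ∈? H i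
    ... | yes x∈Hᵢ = x∈Hᵢ
    ... | no  x∉Hᵢ = contradiction (indep-⊆Hᵢ⇒∣A∣≤rᵢ (minimal _ C∩Hᵢ⊂C) (p∩q⊆q C (H i)))
                                   (<⇒≱ rᵢ<∣C∩Hᵢ∣)
      where
      C∩Hᵢ⊂C : C ∩ H i ⊂ C
      C∩Hᵢ⊂C = p∩q⊆p C (H i) , x , x∈C , λ x∈C∩Hᵢ → x∉Hᵢ (proj₂ (x∈p∩q⁻ C (H i) x∈C∩Hᵢ))

  -- Any r_i + 1 points of H_i form a circuit.
  ∃smallCircuit∋ : ∀ {x} → x ∈ H i → ∃ λ C → SmallCircuit M C × Overfull i C × x ∈ C
  ∃smallCircuit∋ {i} x∈Hᵢ with ∃⊆∋-of-size (H i) x∈Hᵢ (r i) (H-large i)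
  ... | C , C⊆Hᵢ , x∈C , ∣C∣≡1+rᵢ =
    C , ((dependent , minimal) , subst (_≤ n) (sym ∣C∣≡1+rᵢ) (r-small i)) ,
    (C⊆Hᵢ , ≤-reflexive (sym ∣C∣≡1+rᵢ)) , x∈C
    where
    dependent : ¬ Indep M C
    dependent C-indep = 1+n≰n (subst (_≤ r i) ∣C∣≡1+rᵢ (indep-⊆Hᵢ⇒∣A∣≤rᵢ C-indep C⊆Hᵢ))
    minimal : ∀ Y → Y ⊂ C → Indep M Y
    minimal Y Y⊂C = ⊆Hᵢ-indep i (C⊆Hᵢ ∘ p⊂q⇒p⊆q Y⊂C)
      (≤-pred (subst (∣ Y ∣ <_) ∣C∣≡1+rᵢ (p⊂q⇒∣p∣<∣q∣ Y⊂C)))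

  Cl-Overfull : Overfull i C → ∀ x → Cl M C x ⇔ x ∈ H i
  Cl-Overfull {i} {C} (C⊆Hᵢ , rᵢ<∣C∣) x with ∃⊆-of-size C (r i) (<⇒≤ rᵢ<∣C∣)
  ... | T , T⊆C , ∣T∣≡rᵢ = mk⇔ to from
    where
    rank-rᵢ : (∀ {y} → S y → y ∈ H i) → (∀ {y} → y ∈ C → S y) → HasRank M S (r i)
    rank-rᵢ S⊆Hᵢ C⊆S = HasRank-rᵢ i S⊆Hᵢ (C⊆S ∘ T⊆C) ∣T∣≡rᵢ

    from : x ∈ H i → Cl M C x
    from x∈Hᵢ = r i , rank-rᵢ C⊆Hᵢ (λ y∈C → y∈C) , rank-rᵢ C+x⊆Hᵢ inj₁
      where
      C+x⊆Hᵢ : ∀ {y} → y ∈ C ⊎ y ≡ x → y ∈ H i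
      C+x⊆Hᵢ (inj₁ y∈C) = C⊆Hᵢ y∈C
      C+x⊆Hᵢ (inj₂ refl) = x∈Hᵢ

    to : Cl M C x → x ∈ H i
    to (k , rank-C , (_ , ≤k)) with x ∈? H i
    ... | yes x∈Hᵢ = x∈Hᵢ
    ... | no  x∉Hᵢ = contradiction (≤k (T ∪ ⁅ x ⁆) T+x⊆C+x T+x-indep) (subst (_ ≰_) k≡rᵢ ∣T+x∣≰rᵢ)
      where
      k≡rᵢ : r i ≡ k
      k≡rᵢ = HasRank-unique (rank-rᵢ C⊆Hᵢ (λ y∈C → y∈C)) rank-C
      ⁅x⁆⊆∁Hᵢ : ⁅ x ⁆ ⊆ ∁ (H i)
      ⁅x⁆⊆∁Hᵢ y∈⁅x⁆ rewrite x∈⁅y⁆⇒x≡y x y∈⁅x⁆ = x∉p⇒x∈∁p x∉Hᵢ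
      T⊆Hᵢ : T ⊆ H i
      T⊆Hᵢ = C⊆Hᵢ ∘ T⊆C
      T+x⊆C+x : ∀ {y} → y ∈ T ∪ ⁅ x ⁆ → y ∈ C ⊎ y ≡ x
      T+x⊆C+x {y} y∈ with x∈p∪q⁻ T ⁅ x ⁆ y∈
      ... | inj₁ y∈T = inj₁ (T⊆C y∈T)
      ... | inj₂ y∈⁅x⁆ = inj₂ (x∈⁅y⁆⇒x≡y x y∈⁅x⁆)
      T+x-indep : Indep M (T ∪ ⁅ x ⁆)
      T+x-indep = ∪-indep i T⊆Hᵢ (≤-reflexive ∣T∣≡rᵢ) ⁅x⁆⊆∁Hᵢ
        (subst (_≤ n ∸ r i) (sym (∣⁅x⁆∣≡1 x)) (m<n⇒0<n∸m (r-small i)))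
      ∣T+x∣≰rᵢ : ∣ T ∪ ⁅ x ⁆ ∣ ≰ r i
      ∣T+x∣≰rᵢ rewrite ∣p∪q∣≡∣p∣+∣q∣ T ⁅ x ⁆ (p⊆q⇒∁p⊇∁q T⊆Hᵢ ∘ ⁅x⁆⊆∁Hᵢ)
                     | ∣T∣≡rᵢ | ∣⁅x⁆∣≡1 x = m+1+n≰m (r i)

  ∼-refl : _∼_ M C C
  ∼-refl x = (λ x∈cl → x∈cl) , (λ x∈cl → x∈cl)

  ∼-sym : _∼_ M C C′ → _∼_ M C′ C
  ∼-sym C∼C′ x = proj₂ (C∼C′ x) , proj₁ (C∼C′ x)

  Overfull-∼ : Overfull i C → Overfull i C′ → _∼_ M C C′
  Overfull-∼ ov ov′ x =
    Equivalence.from (Cl-Overfull ov′ x) ∘ Equivalence.to (Cl-Overfull ov x) ,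
    Equivalence.from (Cl-Overfull ov x) ∘ Equivalence.to (Cl-Overfull ov′ x)

  Hᵢ⊈Hⱼ : i ≢ j → ∃ λ x → x ∈ H i × x ∉ H j
  Hᵢ⊈Hⱼ {i} {j} i≢j = ∣p∩q∣<∣p∣⇒∃∈p∉q (H i) (H j) (begin-strict
    ∣ H i ∩ H j ∣              ≡⟨ cong ∣_∣ (∩-comm (H i) (H j)) ⟩
    ∣ H j ∩ H i ∣              ≤⟨ m≤m+n ∣ H j ∩ H i ∣ (n ∸ r j) ⟩
    ∣ H j ∩ H i ∣ + (n ∸ r j)  ≤⟨ ∣Hᵢ∩Hₗ∣+[n∸rᵢ]≤rₗ (λ j≡i → i≢j (sym j≡i)) ⟩
    r i                        <⟨ H-large i ⟩
    ∣ H i ∣                    ∎)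
    where open ≤-Reasoning

  Overfull-≁ : i ≢ j → Overfull i C → Overfull j C′ → ¬ _∼_ M C C′
  Overfull-≁ i≢j ov ov′ C∼C′ =
    let x , x∈Hᵢ , x∉Hⱼ = Hᵢ⊈Hⱼ i≢j
    in  x∉Hⱼ (Equivalence.to (Cl-Overfull ov′ x)
                (proj₁ (C∼C′ x) (Equivalence.from (Cl-Overfull ov x) x∈Hᵢ)))

  Pts-Overfull : Overfull i C → ∀ x → Pts M C x ⇔ x ∈ H i
  Pts-Overfull {i} {C} ov x = mk⇔ to from
    where
    to : Pts M C x → x ∈ H i
    to (C′ , C′-circuit , C′∼C , x∈C′) with smallCircuit⇒Overfull C′-circuit
    ... | j , ov′ = Equivalence.to (Cl-Overfull ov x)
                      (proj₁ (C′∼C x) (Equivalence.from (Cl-Overfull ov′ x) (proj₁ ov′ x∈C′)))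
    from : x ∈ H i → Pts M C x
    from x∈Hᵢ with ∃smallCircuit∋ x∈Hᵢ
    ... | C′ , C′-circuit , ov′ , x∈C′ = C′ , C′-circuit , Overfull-∼ ov′ ov , x∈C′

  ∃indep-n-⊆Hᵢ∪Hⱼ : i ≢ j → ∃ λ X → X ⊆ H i ∪ H j × Indep M X × ∣ X ∣ ≡ n
  ∃indep-n-⊆Hᵢ∪Hⱼ {i} {j} i≢j
    with ∃⊆-of-size (H i) (r i) (<⇒≤ (H-large i))
       | ∃⊆-of-size (H j ∩ ∁ (H i)) (n ∸ r i) (n∸rᵢ≤∣Hⱼ∖Hᵢ∣ (λ j≡i → i≢j (sym j≡i)))
  ... | A , A⊆Hᵢ , ∣A∣≡rᵢ | B , B⊆Hⱼ∖Hᵢ , ∣B∣≡n∸rᵢ =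
    A ∪ B , A∪B⊆Hᵢ∪Hⱼ ,
    ∪-indep i A⊆Hᵢ (≤-reflexive ∣A∣≡rᵢ) B⊆∁Hᵢ (≤-reflexive ∣B∣≡n∸rᵢ) ,
    (begin
      ∣ A ∪ B ∣        ≡⟨ ∣p∪q∣≡∣p∣+∣q∣ A B (p⊆q⇒∁p⊇∁q A⊆Hᵢ ∘ B⊆∁Hᵢ) ⟩
      ∣ A ∣ + ∣ B ∣    ≡⟨ cong₂ _+_ ∣A∣≡rᵢ ∣B∣≡n∸rᵢ ⟩
      r i + (n ∸ r i)  ≡⟨ m+[n∸m]≡n (rᵢ≤n i) ⟩
      n                ∎)
    where
    open ≡-Reasoning
    B⊆∁Hᵢ : B ⊆ ∁ (H i)
    B⊆∁Hᵢ = p∩q⊆q (H j) (∁ (H i)) ∘ B⊆Hⱼ∖Hᵢ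
    A∪B⊆Hᵢ∪Hⱼ : A ∪ B ⊆ H i ∪ H j
    A∪B⊆Hᵢ∪Hⱼ y∈ with x∈p∪q⁻ A B y∈
    ... | inj₁ y∈A = x∈p∪q⁺ (inj₁ (A⊆Hᵢ y∈A))
    ... | inj₂ y∈B = x∈p∪q⁺ (inj₂ (p∩q⊆p (H j) (∁ (H i)) (B⊆Hⱼ∖Hᵢ y∈B)))

  HasRank-Pts∪Pts : i ≢ j → Overfull i C → Overfull j C′ →
                    HasRank M (λ x → Pts M C x ⊎ Pts M C′ x) n
  HasRank-Pts∪Pts {i} {j} {C} {C′} i≢j ov ov′ =
    let X , X⊆Hᵢ∪Hⱼ , X-indep , ∣X∣≡n = ∃indep-n-⊆Hᵢ∪Hⱼ i≢j
    in  HasRank-n (Pts⊎Pts ∘ x∈p∪q⁻ (H i) (H j) ∘ X⊆Hᵢ∪Hⱼ) X-indep ∣X∣≡n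
    where
    Pts⊎Pts : ∀ {x} → x ∈ H i ⊎ x ∈ H j → Pts M C x ⊎ Pts M C′ x
    Pts⊎Pts {x} (inj₁ x∈Hᵢ) = inj₁ (Equivalence.from (Pts-Overfull ov x) x∈Hᵢ)
    Pts⊎Pts {x} (inj₂ x∈Hⱼ) = inj₂ (Equivalence.from (Pts-Overfull ov′ x) x∈Hⱼ)

  InL⇒Overfull∋ : ∀ {p} → InL M p C → ∃ λ i → Overfull i C × p ∈ H i
  InL⇒Overfull∋ {p = p} (C-circuit , p∈C) =
    let i , ov = smallCircuit⇒Overfull C-circuit
    in  i , ov , Equivalence.to (Pts-Overfull ov p) p∈C

  ∃InL-Overfull : ∀ {p} → p ∈ H i → ∃ λ C → InL M p C × Overfull i C
  ∃InL-Overfull p∈Hᵢ =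
    let C , C-circuit , ov , p∈C = ∃smallCircuit∋ p∈Hᵢ
    in  C , (C-circuit , C , C-circuit , ∼-refl , p∈C) , ov

  DegAtMost2⇒InL-∼⊎∼ : ∀ {p C₁ C₂} → DegAtMost2 M p → InL M p C₁ → InL M p C₂ →
    ¬ _∼_ M C₁ C₂ → ∀ C → InL M p C → _∼_ M C C₁ ⊎ _∼_ M C C₂
  DegAtMost2⇒InL-∼⊎∼ deg p∈C₁ p∈C₂ C₁≁C₂ C p∈C with deg _ _ C p∈C₁ p∈C₂ p∈C
  ... | inj₁ C₁∼C₂        = contradiction C₁∼C₂ C₁≁C₂
  ... | inj₂ (inj₁ C₁∼C)  = inj₁ (∼-sym C₁∼C)
  ... | inj₂ (inj₂ C₂∼C)  = inj₂ (∼-sym C₂∼C)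

  H∋-unique⇒InL-∼ : ∀ {p} → (∀ {i j} → p ∈ H i → p ∈ H j → i ≡ j) →
                    InL M p C → InL M p C′ → _∼_ M C C′
  H∋-unique⇒InL-∼ unique p∈C p∈C′
    with InL⇒Overfull∋ p∈C | InL⇒Overfull∋ p∈C′
  ... | i , ov , p∈Hᵢ | j , ov′ , p∈Hⱼ with unique p∈Hᵢ p∈Hⱼ
  ...   | refl = Overfull-∼ ov ov′

  H∋-unique⊎two : ∀ p → (∀ {i j} → p ∈ H i → p ∈ H j → i ≡ j)
                        ⊎ ∃₂ λ i j → i ≢ j × p ∈ H i × p ∈ H j
  H∋-unique⊎two p with any? (λ i → any? λ j → ¬? (i ≟ j) ×-dec (p ∈? H i ×-dec p ∈? H j))
  ... | yes (i , j , i≢j , p∈Hᵢ , p∈Hⱼ) = inj₂ (i , j , i≢j , p∈Hᵢ , p∈Hⱼ)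
  ... | no ¬two = inj₁ λ {i} {j} p∈Hᵢ p∈Hⱼ →
    decidable-stable (i ≟ j) λ i≢j → ¬two (i , j , i≢j , p∈Hᵢ , p∈Hⱼ)

lemma4p11 : {n d : ℕ} (M : ElementarySplit n d) (p : Fin d) →
    DegAtMost2 M p → TwoSimple M p
lemma4p11 M p deg with H∋-unique⊎two M p
... | inj₁ unique = inj₁ λ _ _ → H∋-unique⇒InL-∼ M unique
... | inj₂ (i , j , i≢j , p∈Hᵢ , p∈Hⱼ) =
  let C₁ , p∈C₁ , ov₁ = ∃InL-Overfull M p∈Hᵢ
      C₂ , p∈C₂ , ov₂ = ∃InL-Overfull M p∈Hⱼ
      C₁≁C₂           = Overfull-≁ M i≢j ov₁ ov₂
  in  inj₂ (C₁ , C₂ , p∈C₁ , p∈C₂ , C₁≁C₂ ,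
            DegAtMost2⇒InL-∼⊎∼ M deg p∈C₁ p∈C₂ C₁≁C₂ ,
            HasRank-Pts∪Pts M i≢j ov₁ ov₂)
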